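{- Let $M=(E,\rho)$ be a matroid of rank $d\ge1$ with $\#E=m$ and with no loops. Then the characteristic polynomial of $M$ is $$\chi_M(t)=(-1)^d(1-t)\sum_{i=0}^{d-1}\omega_{m-d+1+i}^{i,M}(-t)^i.$$
   Context: The characteristic polynomial is $\chi_M(t)=\sum_{S\in\mathcal{K}(M)}\mu_{\mathcal{K}}(S)\,t^{d-\rho(S)}$, where $\mathcal{K}(M)$ is the lattice of flats of $M$ and $\mu_{\mathcal{K}}(S)$ its Möbius function from the minimum flat to $S$. For $0\le i\le d-1$, let $\mathcal{S}_i^M=\{S\subseteq E:\rho(S)\ge d-i\}$ ordered by inclusion, $\mathcal{L}_i^M=\{\hat0\}\oplus\mathcal{S}_i^M$ (new minimum adjoined), $\mu_i^M(S)$ the Möbius function $\mu(\hat0,S)$ of $\mathcal{L}_i^M$, and for $1\le j\le m-d+1+i$, $\omega_j^{i,M}:=(-1)^j\sum_{S\in\mathcal{S}_i^M:\ \#S-d+1+i=j}\mu_i^M(S)$. -}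

module Defs where

open import Data.Nat as ℕ using (ℕ; zero; suc; _∸_; _≤_; _≤ᵇ_; _≡ᵇ_)
open import Data.Integer as ℤ using (ℤ; 0ℤ; 1ℤ; _+_; _*_; -_; _-_)
open import Data.Bool using (Bool; true; false; if_then_else_; _∧_; not)
open import Data.List using (List; []; _∷_; _++_; map; filter; length; foldr)
open import Data.Vec using (Vec; []; _∷_; tabulate)
open import Data.Maybe using (Maybe; just; nothing)
open import Data.Fin using (Fin)
open import Data.Fin.Subset using (Subset; _⊆_; _∪_; _∩_; ∣_∣; ⁅_⁆; ⊥; ⊤; inside; outside)
open import Data.Fin.Subset.Properties using (_⊆?_)
import Data.Vec.Properties as VecP
import Data.Bool.Properties as BoolP
open import Relation.Nullary using (does)
open import Relation.Binary.PropositionalEquality using (_≡_)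

sumℤ : List ℤ → ℤ
sumℤ = foldr _+_ 0ℤ

sgn : ℕ → ℤ
sgn zero    = 1ℤ
sgn (suc k) = - sgn k

infixr 8 _^ℤ_
_^ℤ_ : ℤ → ℕ → ℤ
x ^ℤ zero    = 1ℤ
x ^ℤ suc k   = x * (x ^ℤ k)

Σ< : ℕ → (ℕ → ℤ) → ℤ
Σ< zero    f = 0ℤ
Σ< (suc n) f = Σ< n f + f n

allSubsets : ∀ n → List (Subset n)
allSubsets zero    = [] ∷ []
allSubsets (suc n) = map (outside ∷_) (allSubsets n) ++ map (inside ∷_) (allSubsets n)

_⊆ᵇ_ : ∀ {n} → Subset n → Subset n → Bool
X ⊆ᵇ Y = does (X ⊆? Y)

_=ᵇ_ : ∀ {n} → Subset n → Subset n → Bool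
X =ᵇ Y = does (VecP.≡-dec BoolP._≟_ X Y)

record Matroid (m : ℕ) : Set where
  field
    ρ        : Subset m → ℕ
    bounded  : ∀ X → ρ X ≤ ∣ X ∣
    monotone : ∀ X Y → X ⊆ Y → ρ X ≤ ρ Y
    submod   : ∀ X Y → ρ (X ∪ Y) ℕ.+ ρ (X ∩ Y) ≤ ρ X ℕ.+ ρ Y

open Matroid public

rank : ∀ {m} → Matroid m → ℕ
rank M = ρ M ⊤

Loopless : ∀ {m} → Matroid m → Set
Loopless {m} M = ∀ (e : Fin m) → ρ M ⁅ e ⁆ ≡ 1

closure : ∀ {m} → Matroid m → Subset m → Subset m
closure M X = tabulate (λ e → ρ M (X ∪ ⁅ e ⁆) ≡ᵇ ρ M X)

isFlat : ∀ {m} → Matroid m → Subset m → Bool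
isFlat M X = closure M X =ᵇ X

flats : ∀ {m} → Matroid m → List (Subset m)
flats {m} M = filter (λ X → BoolP.T? (isFlat M X)) (allSubsets m)

minFlat : ∀ {m} → Matroid m → Subset m
minFlat M = closure M ⊥

-- Computed with fuel; fuel (1 + #elements) always suffices since each
-- recursive call goes strictly down a chain in the poset.

mobiusFuel : ∀ {A : Set} → List A → (A → A → Bool) → (A → A → Bool) →
             ℕ → A → A → ℤ
mobiusFuel els le eq zero    x y = 0ℤ
mobiusFuel els le eq (suc n) x y =
  if eq x y then 1ℤ
  else if le x y then
    - sumℤ (map (λ z → if le x z ∧ le z y ∧ not (eq z y)
                         then mobiusFuel els le eq n x z else 0ℤ) els)
  else 0ℤ

mobius : ∀ {A : Set} → List A → (A → A → Bool) → (A → A → Bool) → A → A → ℤ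
mobius els le eq = mobiusFuel els le eq (suc (length els))

charPoly : ∀ {m} → Matroid m → ℤ → ℤ
charPoly M t =
  sumℤ (map (λ S → mobius (flats M) _⊆ᵇ_ _=ᵇ_ (minFlat M) S
                   * (t ^ℤ (rank M ∸ ρ M S))) (flats M))

-- S_i = { S ⊆ E : ρ(S) ≥ d - i },  L_i = {0̂} ⊕ S_i  (0̂ = nothing)

Sᵢ : ∀ {m} → Matroid m → ℕ → List (Subset m)
Sᵢ {m} M i = filter (λ S → ℕ._≤?_ (rank M ∸ i) (ρ M S)) (allSubsets m)

leL : ∀ {m} → Maybe (Subset m) → Maybe (Subset m) → Bool
leL nothing  _        = true
leL (just _) nothing  = false
leL (just X) (just Y) = X ⊆ᵇ Y

eqL : ∀ {m} → Maybe (Subset m) → Maybe (Subset m) → Bool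
eqL nothing  nothing  = true
eqL nothing  (just _) = false
eqL (just _) nothing  = false
eqL (just X) (just Y) = X =ᵇ Y

Lᵢ : ∀ {m} → Matroid m → ℕ → List (Maybe (Subset m))
Lᵢ M i = nothing ∷ map just (Sᵢ M i)

μᵢ : ∀ {m} → Matroid m → ℕ → Subset m → ℤ
μᵢ M i S = mobius (Lᵢ M i) leL eqL nothing (just S)

-- ω_j^{i,M} = (-1)^j Σ_{S ∈ S_i, #S - d + 1 + i = j} μ_i^M(S)
-- (the condition #S - d + 1 + i = j is written #S + 1 + i = j + d in ℕ)
ω : ∀ {m} → Matroid m → ℕ → ℕ → ℤ
ω M j i = sgn j * sumℤ (map (λ S → if (∣ S ∣ ℕ.+ 1 ℕ.+ i) ≡ᵇ (j ℕ.+ rank M)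
                                  then μᵢ M i S else 0ℤ) (Sᵢ M i))

-- Both sides equal the signed subset sum W(t) = Σ_{S ⊆ E} (-1)^#S t^(d - ρ S).
--
-- Left side (Whitney): the closure of S is a flat, and for a flat F the numbers
-- g(F) = Σ_{cl S = F} (-1)^#S have interval sums Σ_{G ⊆ F} g(G) = Σ_{S ⊆ F} (-1)^#S,
-- which is 1 for F = ∅ and 0 otherwise; so g is the Möbius function μ(∅, -), which
-- starts at ∅ = cl ∅ because M has no loops. Collecting the S by their closures,
-- and using ρ(cl S) = ρ S, turns χ_M(t) into W(t).
--
-- Right side: #S - d + 1 + i = m - d + 1 + i forces S = E, so ω^i is ± μ_i(E).
-- As S_i is closed upwards, Möbius inversion on the Boolean lattice gives
-- μ_i(S) = -Σ_{R ∈ S_i, R ⊆ S} (-1)^(#R + #S), and the coefficient of t^i is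
-- A_i = Σ_{ρ R ≥ d - i} (-1)^#R. Exchanging the two sums, (1 - t) Σ_{i<d} A_i t^i
-- telescopes to W(t) - t^d Σ_R (-1)^#R = W(t), as m ≥ 1.

module Submission where

open import Defs
open import Data.Nat using (ℕ; _≤_; _∸_) renaming (_+_ to _+ℕ_)
open import Data.Integer using (ℤ; 1ℤ; _*_; _-_; -_)
open import Relation.Binary.PropositionalEquality using (_≡_)

open import Data.Bool using (Bool; true; false; T; not; _∧_; if_then_else_)
open import Data.Bool.Properties using (T?)
import Data.Bool.Properties as Bool
open import Data.Empty using (⊥-elim)
open import Data.Fin using (Fin)
open import Data.Fin.Subset using (Subset; _⊆_; _∪_; _∩_; ⁅_⁆; ∣_∣; ⊤; inside; outside)
  renaming (⊥ to ∅; _∈_ to _∈ₛ_)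
open import Data.Fin.Subset.Properties
  using (_⊆?_; _∈?_; ⊆-refl; ⊆-trans; ⊆-antisym; ⊥⊆; ⊆⊤; ∣⊥∣≡0; ∣⊤∣≡n; ∣p∣≡n⇒p≡⊤;
         p⊆p∪q; q⊆p∪q; x∈p∪q⁻; x∈p∩q⁺; x∈⁅x⁆; x∈⁅y⁆⇒x≡y; ∪-identityˡ)
open import Data.Integer using (0ℤ; _+_)
import Data.Integer.Properties as ℤ
open import Algebra.Properties.AbelianGroup ℤ.+-0-abelianGroup using (inverseʳ-unique)
open import Algebra.Properties.CommutativeSemigroup ℤ.*-commutativeSemigroup using (x∙yz≈y∙xz)
open import Data.Integer.Tactic.RingSolver using (solve-∀)
open import Data.List using (List; []; _∷_; _++_; map; filter; length; foldr; allFin)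
import Data.List.Properties as List
open import Data.List.Membership.Propositional using (_∈_)
open import Data.List.Membership.Propositional.Properties
  using (∈-map⁺; ∈-map⁻; ∈-++⁺ˡ; ∈-++⁺ʳ; ∈-filter⁺; ∈-filter⁻; ∈-allFin)
open import Data.List.Relation.Binary.Disjoint.Propositional using (Disjoint)
import Data.List.Relation.Unary.All as All
import Data.List.Relation.Unary.All.Properties as All
open import Data.List.Relation.Unary.AllPairs using ([]; _∷_)
open import Data.List.Relation.Unary.Any using (here; there)
open import Data.List.Relation.Unary.Unique.Propositional using (Unique)
import Data.List.Relation.Unary.Unique.Propositional.Properties as Unique
open import Data.Maybe using (just; nothing; maybe)
import Data.Maybe.Properties as Maybe
open import Data.Nat using (zero; suc; _<_; _≤?_; _≡ᵇ_; z≤n; s≤s; s≤s⁻¹)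
import Data.Nat.Properties as ℕ
open import Data.Nat.Tactic.RingSolver using () renaming (solve-∀ to ℕ-solve-∀)
open import Data.Product using (_×_; _,_; proj₁; proj₂)
open import Data.Sum using ([_,_]′)
open import Data.Vec using (_∷_; [])
import Data.Vec.Properties as Vec
open import Function using (_∘_)
open import Function.Bundles using (Equivalence; mk⇔)
open import Level using (0ℓ)
open import Relation.Binary.PropositionalEquality
  using (refl; sym; trans; cong; cong₂; subst; module ≡-Reasoning)
open import Relation.Nullary using (¬_; Dec; yes; no; does)
open import Relation.Nullary.Decidable using (does-⇔)
open import Relation.Unary using (Pred; Decidable)

private
  variable
    A B : Set

-- Finite sums

∑ : List A → (A → ℤ) → ℤ
∑ xs f = sumℤ (map f xs)

infix 5 ∑
syntax ∑ xs (λ x → e) = ∑[ x ∈ xs ] e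

infixr 8 [_]·_
[_]·_ : Bool → ℤ → ℤ
[ b ]· x = if b then x else 0ℤ

witness : {P : Set} (p? : Dec P) → T (does p?) → P
witness (yes p) _ = p

T-does : {P : Set} (p? : Dec P) → P → T (does p?)
T-does (yes _) _  = _
T-does (no ¬p) p = ¬p p

[]·-true : ∀ {b} x → T b → [ b ]· x ≡ x
[]·-true {true} x _ = refl

[]·-false : ∀ {b} x → ¬ T b → [ b ]· x ≡ 0ℤ
[]·-false {true}  x ¬b = ⊥-elim (¬b _)
[]·-false {false} x _  = refl

[]·-cong : ∀ b {x y} → (T b → x ≡ y) → [ b ]· x ≡ [ b ]· y
[]·-cong true  x≡y = x≡y _
[]·-cong false _   = refl

[]·-neg : ∀ b x → [ b ]· (- x) ≡ - [ b ]· x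
[]·-neg true  x = refl
[]·-neg false x = refl

[]·-*ˡ : ∀ b x y → x * [ b ]· y ≡ [ b ]· (x * y)
[]·-*ˡ true  x y = refl
[]·-*ˡ false x y = ℤ.*-zeroʳ x

[]·-*ʳ : ∀ b x y → [ b ]· x * y ≡ [ b ]· (x * y)
[]·-*ʳ true  x y = refl
[]·-*ʳ false x y = refl

[]·-∧ : ∀ a b x → [ a ]· [ b ]· x ≡ [ a ∧ b ]· x
[]·-∧ true  b x = refl
[]·-∧ false b x = refl

[]·-absorb : ∀ a b x → (T b → T a) → [ a ]· [ b ]· x ≡ [ b ]· x
[]·-absorb true  b     x _   = refl
[]·-absorb false true  x b⇒a = ⊥-elim (b⇒a _)
[]·-absorb false false x _   = refl

[]·-comm : ∀ a b x → [ a ]· [ b ]· x ≡ [ b ]· [ a ]· x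
[]·-comm true  true  x = refl
[]·-comm true  false x = refl
[]·-comm false true  x = refl
[]·-comm false false x = refl

∑-cong : ∀ xs {f g : A → ℤ} → (∀ {x} → x ∈ xs → f x ≡ g x) → ∑ xs f ≡ ∑ xs g
∑-cong []       _   = refl
∑-cong (x ∷ xs) f≗g = cong₂ _+_ (f≗g (here refl)) (∑-cong xs (f≗g ∘ there))

∑-zero : ∀ xs {f : A → ℤ} → (∀ {x} → x ∈ xs → f x ≡ 0ℤ) → ∑ xs f ≡ 0ℤ
∑-zero []       _  = refl
∑-zero (x ∷ xs) f0 = cong₂ _+_ (f0 (here refl)) (∑-zero xs (f0 ∘ there))

∑-++ : ∀ xs ys (f : A → ℤ) → ∑ (xs ++ ys) f ≡ ∑ xs f + ∑ ys f
∑-++ []       ys f = sym (ℤ.+-identityˡ _)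
∑-++ (x ∷ xs) ys f = trans (cong (f x +_) (∑-++ xs ys f)) (sym (ℤ.+-assoc (f x) _ _))

∑-map : ∀ (g : B → A) xs (f : A → ℤ) → ∑ (map g xs) f ≡ ∑ xs (f ∘ g)
∑-map g xs f = cong sumℤ (sym (List.map-∘ xs))

∑-+ : ∀ xs (f g : A → ℤ) → ∑[ x ∈ xs ] (f x + g x) ≡ ∑ xs f + ∑ xs g
∑-+ []       f g = refl
∑-+ (x ∷ xs) f g = trans (cong (f x + g x +_) (∑-+ xs f g)) (interchange (f x) (g x) _ _)
  where
  interchange : ∀ a b c d → a + b + (c + d) ≡ a + c + (b + d)
  interchange = solve-∀

∑-neg : ∀ xs (f : A → ℤ) → - ∑ xs f ≡ ∑[ x ∈ xs ] - f x
∑-neg []       f = refl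
∑-neg (x ∷ xs) f = trans (ℤ.neg-distrib-+ (f x) _) (cong (- f x +_) (∑-neg xs f))

∑-*ˡ : ∀ c xs (f : A → ℤ) → c * ∑ xs f ≡ ∑[ x ∈ xs ] c * f x
∑-*ˡ c []       f = ℤ.*-zeroʳ c
∑-*ˡ c (x ∷ xs) f = trans (ℤ.*-distribˡ-+ c (f x) _) (cong (c * f x +_) (∑-*ˡ c xs f))

∑-*ʳ : ∀ c xs (f : A → ℤ) → ∑ xs f * c ≡ ∑[ x ∈ xs ] f x * c
∑-*ʳ c []       f = refl
∑-*ʳ c (x ∷ xs) f = trans (ℤ.*-distribʳ-+ c (f x) _) (cong (f x * c +_) (∑-*ʳ c xs f))

[]·-∑ : ∀ b xs (f : A → ℤ) → [ b ]· ∑ xs f ≡ ∑[ x ∈ xs ] [ b ]· f x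
[]·-∑ true  xs f = refl
[]·-∑ false xs f = sym (∑-zero xs (λ _ → refl))

∑-comm : ∀ xs (ys : List B) (f : A → B → ℤ) →
         ∑[ x ∈ xs ] ∑[ y ∈ ys ] f x y ≡ ∑[ y ∈ ys ] ∑[ x ∈ xs ] f x y
∑-comm []       ys f = sym (∑-zero ys (λ _ → refl))
∑-comm (x ∷ xs) ys f =
  trans (cong (∑ ys (f x) +_) (∑-comm xs ys f)) (sym (∑-+ ys (f x) (λ y → ∑[ x ∈ xs ] f x y)))

∑-[]·-neg : ∀ xs (p : A → Bool) (f : A → ℤ) → ∑[ x ∈ xs ] [ p x ]· - f x ≡ - (∑[ x ∈ xs ] [ p x ]· f x)
∑-[]·-neg xs p f = trans (∑-cong xs (λ {x} _ → []·-neg (p x) (f x))) (sym (∑-neg xs _))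

∑-filter : ∀ {P : Pred A 0ℓ} (P? : Decidable P) xs (f : A → ℤ) →
           ∑ (filter P? xs) f ≡ ∑[ x ∈ xs ] [ does (P? x) ]· f x
∑-filter P? []       f = refl
∑-filter P? (x ∷ xs) f with does (P? x)
... | true  = cong (f x +_) (∑-filter P? xs f)
... | false = trans (∑-filter P? xs f) (sym (ℤ.+-identityˡ _))

∑-filter-redundant : ∀ {P : Pred A 0ℓ} (P? : Decidable P) xs (p : A → Bool) (f : A → ℤ) →
                     (∀ {x} → T (p x) → P x) →
                     ∑[ x ∈ filter P? xs ] [ p x ]· f x ≡ ∑[ x ∈ xs ] [ p x ]· f x
∑-filter-redundant P? xs p f p⇒P =
  trans (∑-filter P? xs _) (∑-cong xs (λ {x} _ → []·-absorb _ (p x) _ (T-does (P? x) ∘ p⇒P)))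

∑-pick : ∀ {xs} {y : A} (p : A → Bool) (f : A → ℤ) → Unique xs → y ∈ xs →
         (∀ {z} → T (p z) → z ≡ y) → T (p y) → ∑[ z ∈ xs ] [ p z ]· f z ≡ f y
∑-pick {xs = _ ∷ xs} p f (y∉xs ∷ _) (here refl) p⇒≡ py = begin
    [ p _ ]· f _ + (∑[ z ∈ xs ] [ p z ]· f z)
  ≡⟨ cong₂ _+_ ([]·-true _ py) (∑-zero xs (λ z∈ → []·-false _ (λ pz → All.lookup y∉xs z∈ (sym (p⇒≡ pz))))) ⟩
    f _ + 0ℤ
  ≡⟨ ℤ.+-identityʳ _ ⟩
    f _ ∎
  where open ≡-Reasoning
∑-pick p f (x∉xs ∷ unique) (there y∈) p⇒≡ py =
  trans (cong₂ _+_ ([]·-false _ (λ px → All.lookup x∉xs y∈ (p⇒≡ px))) (∑-pick p f unique y∈ p⇒≡ py))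
        (ℤ.+-identityˡ _)

Σ<-cong : ∀ n {f g : ℕ → ℤ} → (∀ i → f i ≡ g i) → Σ< n f ≡ Σ< n g
Σ<-cong zero    f≗g = refl
Σ<-cong (suc n) f≗g = cong₂ _+_ (Σ<-cong n f≗g) (f≗g n)

Σ<-zero : ∀ n {f : ℕ → ℤ} → (∀ {i} → i < n → f i ≡ 0ℤ) → Σ< n f ≡ 0ℤ
Σ<-zero zero    _  = refl
Σ<-zero (suc n) f0 = cong₂ _+_ (Σ<-zero n (f0 ∘ ℕ.m≤n⇒m≤1+n)) (f0 ℕ.≤-refl)

Σ<-*ˡ : ∀ c n (f : ℕ → ℤ) → c * Σ< n f ≡ Σ< n (λ i → c * f i)
Σ<-*ˡ c zero    f = ℤ.*-zeroʳ c
Σ<-*ˡ c (suc n) f = trans (ℤ.*-distribˡ-+ c _ (f n)) (cong (_+ c * f n) (Σ<-*ˡ c n f))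

Σ<-∑-comm : ∀ n xs (f : ℕ → A → ℤ) → Σ< n (λ i → ∑[ x ∈ xs ] f i x) ≡ ∑[ x ∈ xs ] Σ< n (λ i → f i x)
Σ<-∑-comm zero    xs f = sym (∑-zero xs (λ _ → refl))
Σ<-∑-comm (suc n) xs f = trans (cong (_+ ∑ xs (f n)) (Σ<-∑-comm n xs f)) (sym (∑-+ xs _ (f n)))

-- Signs and geometric sums

sgn-+ : ∀ a b → sgn (a +ℕ b) ≡ sgn a * sgn b
sgn-+ zero    b = sym (ℤ.*-identityˡ (sgn b))
sgn-+ (suc a) b = trans (cong -_ (sgn-+ a b)) (ℤ.neg-distribˡ-* (sgn a) (sgn b))

sgn-square : ∀ k → sgn k * sgn k ≡ 1ℤ
sgn-square zero    = refl
sgn-square (suc k) = trans (neg-square (sgn k)) (sgn-square k)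
  where
  neg-square : ∀ s → - s * - s ≡ s * s
  neg-square = solve-∀

neg-^ : ∀ t i → (- t) ^ℤ i ≡ sgn i * t ^ℤ i
neg-^ t zero    = refl
neg-^ t (suc i) = trans (cong (- t *_) (neg-^ t i)) (swap-neg t (sgn i) (t ^ℤ i))
  where
  swap-neg : ∀ t s p → - t * (s * p) ≡ - s * (t * p)
  swap-neg = solve-∀

geometric : ∀ t {k} d → k ≤ d → (1ℤ - t) * Σ< d (λ i → [ does (k ≤? i) ]· t ^ℤ i) ≡ t ^ℤ k - t ^ℤ d
geometric t zero z≤n = trans (ℤ.*-zeroʳ (1ℤ - t)) (sym (ℤ.+-inverseʳ 1ℤ))
geometric t {k} (suc d) k≤1+d with k ≤? d
... | yes k≤d = begin
    (1ℤ - t) * (Σ< d f + f d)             ≡⟨ cong (λ x → (1ℤ - t) * (Σ< d f + x)) ([]·-true _ (T-does (k ≤? d) k≤d)) ⟩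
    (1ℤ - t) * (Σ< d f + t ^ℤ d)          ≡⟨ ℤ.*-distribˡ-+ (1ℤ - t) _ _ ⟩
    (1ℤ - t) * Σ< d f + (1ℤ - t) * t ^ℤ d  ≡⟨ cong (_+ (1ℤ - t) * t ^ℤ d) (geometric t d k≤d) ⟩
    t ^ℤ k - t ^ℤ d + (1ℤ - t) * t ^ℤ d    ≡⟨ telescope (t ^ℤ k) (t ^ℤ d) t ⟩
    t ^ℤ k - t * t ^ℤ d                    ∎
  where
  open ≡-Reasoning
  f : ℕ → ℤ
  f i = [ does (k ≤? i) ]· t ^ℤ i
  telescope : ∀ a b t → a - b + (1ℤ - t) * b ≡ a - t * b
  telescope = solve-∀
... | no k≰d rewrite ℕ.≤-antisym k≤1+d (ℕ.≰⇒> k≰d) = begin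
    (1ℤ - t) * Σ< (suc d) f  ≡⟨ cong ((1ℤ - t) *_) (Σ<-zero (suc d) (λ i<1+d → []·-false _ (i≱1+d i<1+d))) ⟩
    (1ℤ - t) * 0ℤ            ≡⟨ ℤ.*-zeroʳ (1ℤ - t) ⟩
    0ℤ                       ≡⟨ sym (ℤ.+-inverseʳ (t ^ℤ suc d)) ⟩
    t ^ℤ suc d - t ^ℤ suc d  ∎
  where
  open ≡-Reasoning
  f : ℕ → ℤ
  f i = [ does (suc d ≤? i) ]· t ^ℤ i
  i≱1+d : ∀ {i} → i < suc d → ¬ T (does (suc d ≤? i))
  i≱1+d {i} i<1+d = ℕ.<⇒≱ i<1+d ∘ witness (suc d ≤? i)

∸-≤-swap : ∀ d i r → d ∸ i ≤ r → d ∸ r ≤ i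
∸-≤-swap d i r d∸i≤r =
  ℕ.m≤n+o⇒m∸n≤o d r (subst (d ≤_) (ℕ.+-comm i r) (ℕ.≤-trans (ℕ.m≤n+m∸n d i) (ℕ.+-monoʳ-≤ i d∸i≤r)))

∑-geometric : ∀ (xs : List A) (w : A → ℤ) (r : A → ℕ) d t →
  (1ℤ - t) * Σ< d (λ i → (∑[ x ∈ xs ] [ does (d ∸ i ≤? r x) ]· w x) * t ^ℤ i)
    ≡ ∑[ x ∈ xs ] w x * (t ^ℤ (d ∸ r x) - t ^ℤ d)
∑-geometric xs w r d t = begin
  (1ℤ - t) * Σ< d (λ i → (∑[ x ∈ xs ] [ does (d ∸ i ≤? r x) ]· w x) * t ^ℤ i)
    ≡⟨ cong ((1ℤ - t) *_) (Σ<-cong d (λ i → trans (∑-*ʳ (t ^ℤ i) xs _) (∑-cong xs (λ {x} _ → swap-bracket x i)))) ⟩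
  (1ℤ - t) * Σ< d (λ i → ∑[ x ∈ xs ] w x * ([ does (d ∸ r x ≤? i) ]· t ^ℤ i))
    ≡⟨ cong ((1ℤ - t) *_) (Σ<-∑-comm d xs _) ⟩
  (1ℤ - t) * (∑[ x ∈ xs ] Σ< d (λ i → w x * ([ does (d ∸ r x ≤? i) ]· t ^ℤ i)))
    ≡⟨ ∑-*ˡ (1ℤ - t) xs _ ⟩
  ∑[ x ∈ xs ] (1ℤ - t) * Σ< d (λ i → w x * ([ does (d ∸ r x ≤? i) ]· t ^ℤ i))
    ≡⟨ ∑-cong xs (λ {x} _ → per-element x) ⟩
  ∑[ x ∈ xs ] w x * (t ^ℤ (d ∸ r x) - t ^ℤ d) ∎
  where
  open ≡-Reasoning
  swap-bracket : ∀ x i → [ does (d ∸ i ≤? r x) ]· w x * t ^ℤ i ≡ w x * [ does (d ∸ r x ≤? i) ]· t ^ℤ i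
  swap-bracket x i = begin
    [ does (d ∸ i ≤? r x) ]· w x * t ^ℤ i    ≡⟨ []·-*ʳ _ (w x) (t ^ℤ i) ⟩
    [ does (d ∸ i ≤? r x) ]· (w x * t ^ℤ i)  ≡⟨ cong ([_]· (w x * t ^ℤ i)) (does-⇔ swap (d ∸ i ≤? r x) (d ∸ r x ≤? i)) ⟩
    [ does (d ∸ r x ≤? i) ]· (w x * t ^ℤ i)  ≡⟨ sym ([]·-*ˡ _ (w x) (t ^ℤ i)) ⟩
    w x * [ does (d ∸ r x ≤? i) ]· t ^ℤ i    ∎
    where swap = mk⇔ (∸-≤-swap d i (r x)) (∸-≤-swap d (r x) i)
  per-element : ∀ x → (1ℤ - t) * Σ< d (λ i → w x * ([ does (d ∸ r x ≤? i) ]· t ^ℤ i))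
                      ≡ w x * (t ^ℤ (d ∸ r x) - t ^ℤ d)
  per-element x = begin
    (1ℤ - t) * Σ< d (λ i → w x * g i)  ≡⟨ cong ((1ℤ - t) *_) (sym (Σ<-*ˡ (w x) d g)) ⟩
    (1ℤ - t) * (w x * Σ< d g)          ≡⟨ x∙yz≈y∙xz (1ℤ - t) (w x) (Σ< d g) ⟩
    w x * ((1ℤ - t) * Σ< d g)          ≡⟨ cong (w x *_) (geometric t d (ℕ.m∸n≤m d (r x))) ⟩
    w x * (t ^ℤ (d ∸ r x) - t ^ℤ d)    ∎
    where
    g : ℕ → ℤ
    g i = [ does (d ∸ r x ≤? i) ]· t ^ℤ i

-- Möbius functions of finite posets

count : (A → Bool) → List A → ℕ
count p []       = 0
count p (x ∷ xs) = if p x then suc (count p xs) else count p xs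

count≤length : ∀ (p : A → Bool) xs → count p xs ≤ length xs
count≤length p []       = z≤n
count≤length p (x ∷ xs) with p x
... | true  = s≤s (count≤length p xs)
... | false = ℕ.m≤n⇒m≤1+n (count≤length p xs)

count-mono : ∀ (p q : A → Bool) → (∀ {x} → T (p x) → T (q x)) → ∀ xs → count p xs ≤ count q xs
count-mono p q p⇒q []       = z≤n
count-mono p q p⇒q (x ∷ xs) with p x | q x | p⇒q {x}
... | true  | true  | _   = s≤s (count-mono p q p⇒q xs)
... | true  | false | p⇒q = ⊥-elim (p⇒q _)
... | false | true  | _   = ℕ.m≤n⇒m≤1+n (count-mono p q p⇒q xs)
... | false | false | _   = count-mono p q p⇒q xs

count-mono-< : ∀ (p q : A → Bool) → (∀ {x} → T (p x) → T (q x)) →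
               ∀ {z xs} → z ∈ xs → T (q z) → ¬ T (p z) → count p xs < count q xs
count-mono-< p q p⇒q {z} {_ ∷ xs} (here refl) qz ¬pz with p z | q z
... | true  | _     = ⊥-elim (¬pz _)
... | false | true  = s≤s (count-mono p q p⇒q xs)
count-mono-< p q p⇒q {xs = x ∷ xs} (there z∈) qz ¬pz with p x | q x | p⇒q {x}
... | true  | true  | _   = s≤s (count-mono-< p q p⇒q z∈ qz ¬pz)
... | true  | false | p⇒q = ⊥-elim (p⇒q _)
... | false | true  | _   = ℕ.m≤n⇒m≤1+n (count-mono-< p q p⇒q z∈ qz ¬pz)
... | false | false | _   = count-mono-< p q p⇒q z∈ qz ¬pz

T-∧-not⁻ : ∀ a b c → T (a ∧ b ∧ not c) → T a × T b × ¬ T c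
T-∧-not⁻ true true false _ = _ , _ , λ ()

T-∧-not⁺ : ∀ {a b c} → T a → T b → ¬ T c → T (a ∧ b ∧ not c)
T-∧-not⁺ {true} {true} {false} _ _ _  = _
T-∧-not⁺ {true} {true} {true}  _ _ ¬c = ¬c _

[]·-split : ∀ {a b c} x → T a → (T c → T b) → [ b ]· x ≡ [ a ∧ b ∧ not c ]· x + [ c ]· x
[]·-split {true} {true}  {true}  x _ _   = sym (ℤ.+-identityˡ x)
[]·-split {true} {true}  {false} x _ _   = sym (ℤ.+-identityʳ x)
[]·-split {true} {false} {true}  x _ c⇒b = ⊥-elim (c⇒b _)
[]·-split {true} {false} {false} x _ _   = refl

T-∧⁻ : ∀ {a b} → T (a ∧ b) → T a × T b
T-∧⁻ = Equivalence.to Bool.T-∧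

record IsBoolPoset (le eq : A → A → Bool) : Set where
  field
    eq⇒≡       : ∀ {a b} → T (eq a b) → a ≡ b
    eq-refl    : ∀ a → T (eq a a)
    le-refl    : ∀ a → T (le a a)
    le-trans   : ∀ {a b c} → T (le a b) → T (le b c) → T (le a c)
    le-antisym : ∀ {a b} → T (le a b) → T (le b a) → a ≡ b

-- mobiusFuel els le eq (suc n) x is definitionally mobiusStep els le eq x (mobiusFuel els le eq n x).
mobiusStep : List A → (A → A → Bool) → (A → A → Bool) → A → (A → ℤ) → A → ℤ
mobiusStep els le eq x f y =
  if eq x y then 1ℤ
  else if le x y then - (∑[ z ∈ els ] [ le x z ∧ le z y ∧ not (eq z y) ]· f z)
  else 0ℤ

module Mobius {le eq : A → A → Bool} (poset : IsBoolPoset le eq) (els : List A) (x : A) where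
  open IsBoolPoset poset

  between : A → A → Bool
  between y z = le x z ∧ le z y ∧ not (eq z y)

  between⁻ : ∀ {y z} → T (between y z) → T (le x z) × T (le z y) × ¬ T (eq z y)
  between⁻ {y} {z} = T-∧-not⁻ (le x z) (le z y) (eq z y)

  between-trans : ∀ {y z w} → T (between y z) → T (between z w) → T (between y w)
  between-trans {y} {z} {w} yz zw with between⁻ yz | between⁻ zw
  ... | _ , z≤y , z≢y | x≤w , w≤z , _ = T-∧-not⁺ x≤w (le-trans w≤z z≤y) w≢y
    where
    w≢y : ¬ T (eq w y)
    w≢y w=y with eq⇒≡ w=y
    ... | refl = z≢y (subst (λ v → T (eq z v)) (le-antisym z≤y w≤z) (eq-refl z))

  between-irrefl : ∀ z → ¬ T (between z z)
  between-irrefl z zz with between⁻ zz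
  ... | _ , _ , z≢z = z≢z (eq-refl z)

  height : A → ℕ
  height y = count (between y) els

  height-< : ∀ {y z} → z ∈ els → T (between y z) → height z < height y
  height-< {y} {z} z∈ yz = count-mono-< (between z) (between y) (between-trans yz) z∈ yz (between-irrefl z)

  mobiusStep-cong : ∀ {f g} y → (∀ {z} → z ∈ els → T (between y z) → f z ≡ g z) →
                    mobiusStep els le eq x f y ≡ mobiusStep els le eq x g y
  mobiusStep-cong y f≗g with eq x y | le x y
  ... | true  | _     = refl
  ... | false | false = refl
  ... | false | true  = cong -_ (∑-cong els (λ z∈ → []·-cong _ (f≗g z∈)))

  mobius-unique : ∀ {f} → (∀ {y} → y ∈ els → f y ≡ mobiusStep els le eq x f y) →
                  ∀ {y} → y ∈ els → mobius els le eq x y ≡ f y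
  mobius-unique {f} f-rec y∈ = fuelled (suc (length els)) y∈ (s≤s (count≤length _ els))
    where
    fuelled : ∀ n {y} → y ∈ els → height y < n → mobiusFuel els le eq n x y ≡ f y
    fuelled (suc n) {y} y∈ h<n =
      trans (mobiusStep-cong y (λ z∈ yz → fuelled n z∈ (ℕ.<-≤-trans (height-< z∈ yz) (s≤s⁻¹ h<n))))
            (sym (f-rec y∈))

  mobius-intervalSums : Unique els → (∀ y → T (le x y)) → ∀ {f} →
                        (∀ {y} → y ∈ els → ∑[ z ∈ els ] [ le z y ]· f z ≡ [ eq x y ]· 1ℤ) →
                        ∀ {y} → y ∈ els → mobius els le eq x y ≡ f y
  mobius-intervalSums unique x-least {f} intervalSum = mobius-unique recursion
    where
    lowerSum : A → ℤ
    lowerSum y = ∑[ z ∈ els ] [ between y z ]· f z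

    split : ∀ {y} → y ∈ els → lowerSum y + f y ≡ [ eq x y ]· 1ℤ
    split {y} y∈ = begin
      lowerSum y + f y
        ≡⟨ cong (lowerSum y +_) (sym (∑-pick (λ z → eq z y) f unique y∈ eq⇒≡ (eq-refl y))) ⟩
      lowerSum y + (∑[ z ∈ els ] [ eq z y ]· f z)
        ≡⟨ sym (∑-+ els _ _) ⟩
      ∑[ z ∈ els ] ([ between y z ]· f z + [ eq z y ]· f z)
        ≡⟨ sym (∑-cong els (λ {z} _ → []·-split (f z) (x-least z) (z=y⇒z≤y z))) ⟩
      ∑[ z ∈ els ] [ le z y ]· f z
        ≡⟨ intervalSum y∈ ⟩
      [ eq x y ]· 1ℤ ∎
      where
      open ≡-Reasoning
      z=y⇒z≤y : ∀ z → T (eq z y) → T (le z y)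
      z=y⇒z≤y z z=y = subst (λ v → T (le v y)) (sym (eq⇒≡ z=y)) (le-refl y)

    nothing-below-x : ∀ z → ¬ T (between x z)
    nothing-below-x z xz with between⁻ xz
    ... | x≤z , z≤x , z≢x = z≢x (subst (λ v → T (eq v x)) (le-antisym x≤z z≤x) (eq-refl x))

    recursion : ∀ {y} → y ∈ els → f y ≡ mobiusStep els le eq x f y
    recursion {y} y∈ with eq x y in x=y | split y∈
    ... | true  | sum≡1 with refl ← eq⇒≡ (subst T (sym x=y) _) =
      trans (sym (ℤ.+-identityˡ (f x)))
            (trans (cong (_+ f x) (sym (∑-zero els (λ {z} _ → []·-false _ (nothing-below-x z))))) sum≡1)
    ... | false | sum≡0 with le x y | x-least y
    ...   | true | _ = inverseʳ-unique (lowerSum y) (f y) sum≡0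

-- The Boolean lattice

module _ {n : ℕ} (X Y : Subset n) where

  ⊆ᵇ⇒⊆ : T (X ⊆ᵇ Y) → X ⊆ Y
  ⊆ᵇ⇒⊆ = witness (X ⊆? Y)

  ⊆⇒⊆ᵇ : X ⊆ Y → T (X ⊆ᵇ Y)
  ⊆⇒⊆ᵇ = T-does (X ⊆? Y)

  =ᵇ⇒≡ : T (X =ᵇ Y) → X ≡ Y
  =ᵇ⇒≡ = witness (Vec.≡-dec Bool._≟_ X Y)

  ≡⇒=ᵇ : X ≡ Y → T (X =ᵇ Y)
  ≡⇒=ᵇ = T-does (Vec.≡-dec Bool._≟_ X Y)

⊆ᵇ-isBoolPoset : ∀ {n} → IsBoolPoset (_⊆ᵇ_ {n}) _=ᵇ_
⊆ᵇ-isBoolPoset = record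
  { eq⇒≡       = λ {X} {Y} → =ᵇ⇒≡ X Y
  ; eq-refl    = λ X → ≡⇒=ᵇ X X refl
  ; le-refl    = λ X → ⊆⇒⊆ᵇ X X ⊆-refl
  ; le-trans   = λ {X} {Y} {Z} p q → ⊆⇒⊆ᵇ X Z (⊆-trans (⊆ᵇ⇒⊆ X Y p) (⊆ᵇ⇒⊆ Y Z q))
  ; le-antisym = λ {X} {Y} p q → ⊆-antisym (⊆ᵇ⇒⊆ X Y p) (⊆ᵇ⇒⊆ Y X q)
  }

leL-isBoolPoset : ∀ {n} → IsBoolPoset (leL {n}) eqL
leL-isBoolPoset = record
  { eq⇒≡       = λ {a} {b} → eq⇒≡ a b
  ; eq-refl    = λ { nothing → _ ; (just X) → ≡⇒=ᵇ X X refl }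
  ; le-refl    = λ { nothing → _ ; (just X) → ⊆⇒⊆ᵇ X X ⊆-refl }
  ; le-trans   = λ {a} {b} {c} → le-trans a b c
  ; le-antisym = λ {a} {b} → le-antisym a b
  }
  where
  eq⇒≡ : ∀ a b → T (eqL a b) → a ≡ b
  eq⇒≡ nothing  nothing  _   = refl
  eq⇒≡ (just X) (just Y) X=Y = cong just (=ᵇ⇒≡ X Y X=Y)
  le-trans : ∀ a b c → T (leL a b) → T (leL b c) → T (leL a c)
  le-trans nothing  _        _        _   _   = _
  le-trans (just X) (just Y) (just Z) X⊆Y Y⊆Z = ⊆⇒⊆ᵇ X Z (⊆-trans (⊆ᵇ⇒⊆ X Y X⊆Y) (⊆ᵇ⇒⊆ Y Z Y⊆Z))
  le-antisym : ∀ a b → T (leL a b) → T (leL b a) → a ≡ b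
  le-antisym nothing  nothing  _   _   = refl
  le-antisym (just X) (just Y) X⊆Y Y⊆X = cong just (⊆-antisym (⊆ᵇ⇒⊆ X Y X⊆Y) (⊆ᵇ⇒⊆ Y X Y⊆X))

allSubsets-complete : ∀ {n} (X : Subset n) → X ∈ allSubsets n
allSubsets-complete []                  = here refl
allSubsets-complete (outside ∷ X)       = ∈-++⁺ˡ (∈-map⁺ (outside ∷_) (allSubsets-complete X))
allSubsets-complete {suc n} (inside ∷ X) =
  ∈-++⁺ʳ (map (outside ∷_) (allSubsets n)) (∈-map⁺ (inside ∷_) (allSubsets-complete X))

allSubsets-unique : ∀ n → Unique (allSubsets n)
allSubsets-unique zero    = All.[] ∷ []
allSubsets-unique (suc n) = Unique.++⁺ (Unique.map⁺ Vec.∷-injectiveʳ (allSubsets-unique n))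
                                       (Unique.map⁺ Vec.∷-injectiveʳ (allSubsets-unique n))
                                       disjoint
  where
  disjoint : Disjoint (map (outside ∷_) (allSubsets n)) (map (inside ∷_) (allSubsets n))
  disjoint (v∈out , v∈in) with ∈-map⁻ (outside ∷_) v∈out | ∈-map⁻ (inside ∷_) v∈in
  ... | _ , _ , refl | _ , _ , ()

∑-allSubsets-suc : ∀ n (f : Subset (suc n) → ℤ) →
  ∑ (allSubsets (suc n)) f ≡ (∑[ X ∈ allSubsets n ] f (outside ∷ X)) + (∑[ X ∈ allSubsets n ] f (inside ∷ X))
∑-allSubsets-suc n f = trans (∑-++ (map (outside ∷_) (allSubsets n)) _ f)
                             (cong₂ _+_ (∑-map (outside ∷_) (allSubsets n) f) (∑-map (inside ∷_) (allSubsets n) f))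

∑-sgn-allSubsets : ∀ n → ∑[ S ∈ allSubsets (suc n) ] sgn ∣ S ∣ ≡ 0ℤ
∑-sgn-allSubsets n = begin
  ∑[ S ∈ allSubsets (suc n) ] sgn ∣ S ∣                       ≡⟨ ∑-allSubsets-suc n _ ⟩
  s + (∑[ S ∈ allSubsets n ] - sgn ∣ S ∣)                     ≡⟨ cong (s +_) (sym (∑-neg (allSubsets n) _)) ⟩
  s - s                                                       ≡⟨ ℤ.+-inverseʳ s ⟩
  0ℤ                                                          ∎
  where
  open ≡-Reasoning
  s = ∑[ S ∈ allSubsets n ] sgn ∣ S ∣

private
  alternating : ∀ {n} → Subset n → Subset n → ℤ
  alternating R S = ∑[ T ∈ allSubsets _ ] [ R ⊆ᵇ T ∧ T ⊆ᵇ S ]· sgn ∣ T ∣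

  vanishes : ∀ {n} (R : Subset n) {g : Subset n → ℤ} → ∑[ T ∈ allSubsets n ] [ R ⊆ᵇ T ∧ false ]· g T ≡ 0ℤ
  vanishes R = ∑-zero (allSubsets _) (λ {T} _ → cong ([_]· _) (Bool.∧-zeroʳ (R ⊆ᵇ T)))

  negated : ∀ {n} (R S : Subset n) →
            ∑[ T ∈ allSubsets n ] [ R ⊆ᵇ T ∧ T ⊆ᵇ S ]· - sgn ∣ T ∣ ≡ - alternating R S
  negated R S = ∑-[]·-neg (allSubsets _) (λ T → R ⊆ᵇ T ∧ T ⊆ᵇ S) (λ T → sgn ∣ T ∣)

-- ⊆ᵇ, =ᵇ and ∣_∣ compute on leading bits, so each case splits the sum by the first bit of T.
∑-sgn-interval : ∀ {n} (R S : Subset n) →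
                 ∑[ T ∈ allSubsets n ] [ R ⊆ᵇ T ∧ T ⊆ᵇ S ]· sgn ∣ T ∣ ≡ [ R =ᵇ S ]· sgn ∣ S ∣
∑-sgn-interval []      []      = refl
∑-sgn-interval {suc n} (outside ∷ R) (outside ∷ S) = begin
  _                                                  ≡⟨ ∑-allSubsets-suc n _ ⟩
  alternating R S + (∑[ T ∈ allSubsets n ] [ R ⊆ᵇ T ∧ false ]· - sgn ∣ T ∣)
                                                     ≡⟨ cong₂ _+_ (∑-sgn-interval R S) (vanishes R) ⟩
  [ R =ᵇ S ]· sgn ∣ S ∣ + 0ℤ                          ≡⟨ ℤ.+-identityʳ _ ⟩
  [ R =ᵇ S ]· sgn ∣ S ∣                               ∎
  where open ≡-Reasoning
∑-sgn-interval {suc n} (outside ∷ R) (inside ∷ S) = begin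
  _                                                  ≡⟨ ∑-allSubsets-suc n _ ⟩
  alternating R S + (∑[ T ∈ allSubsets n ] [ R ⊆ᵇ T ∧ T ⊆ᵇ S ]· - sgn ∣ T ∣)
                                                     ≡⟨ cong (alternating R S +_) (negated R S) ⟩
  alternating R S - alternating R S                  ≡⟨ ℤ.+-inverseʳ (alternating R S) ⟩
  0ℤ                                                 ∎
  where open ≡-Reasoning
∑-sgn-interval {suc n} (inside ∷ R) (outside ∷ S) =
  trans (∑-allSubsets-suc n _) (cong₂ _+_ (∑-zero (allSubsets n) (λ _ → refl)) (vanishes R))
∑-sgn-interval {suc n} (inside ∷ R) (inside ∷ S) = begin
  _                                                  ≡⟨ ∑-allSubsets-suc n _ ⟩
  (∑[ T ∈ allSubsets n ] [ false ]· sgn ∣ T ∣) + (∑[ T ∈ allSubsets n ] [ R ⊆ᵇ T ∧ T ⊆ᵇ S ]· - sgn ∣ T ∣)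
                                                     ≡⟨ cong₂ _+_ (∑-zero (allSubsets n) (λ _ → refl)) (negated R S) ⟩
  0ℤ - alternating R S                               ≡⟨ ℤ.+-identityˡ _ ⟩
  - alternating R S                                  ≡⟨ cong -_ (∑-sgn-interval R S) ⟩
  - [ R =ᵇ S ]· sgn ∣ S ∣                             ≡⟨ sym ([]·-neg (R =ᵇ S) _) ⟩
  [ R =ᵇ S ]· - sgn ∣ S ∣                             ∎
  where open ≡-Reasoning

∑-sgn-shift : ∀ {n} → 1 ≤ n → ∀ (f : Subset n → ℤ) c →
              ∑[ S ∈ allSubsets n ] sgn ∣ S ∣ * (f S - c) ≡ ∑[ S ∈ allSubsets n ] sgn ∣ S ∣ * f S
∑-sgn-shift {suc n} _ f c = begin
  ∑[ S ∈ U ] sgn ∣ S ∣ * (f S - c)                  ≡⟨ ∑-cong U (λ {S} _ → distrib (sgn ∣ S ∣) (f S) c) ⟩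
  ∑[ S ∈ U ] (sgn ∣ S ∣ * f S + - c * sgn ∣ S ∣)    ≡⟨ ∑-+ U _ _ ⟩
  signed + (∑[ S ∈ U ] - c * sgn ∣ S ∣)              ≡⟨ cong (signed +_) (sym (∑-*ˡ (- c) U _)) ⟩
  signed + - c * (∑[ S ∈ U ] sgn ∣ S ∣)              ≡⟨ cong (λ s → signed + - c * s) (∑-sgn-allSubsets n) ⟩
  signed + - c * 0ℤ                                 ≡⟨ cong (signed +_) (ℤ.*-zeroʳ (- c)) ⟩
  signed + 0ℤ                                       ≡⟨ ℤ.+-identityʳ signed ⟩
  signed                                            ∎
  where
  open ≡-Reasoning
  U = allSubsets (suc n)
  signed = ∑[ S ∈ U ] sgn ∣ S ∣ * f S
  distrib : ∀ s a c → s * (a - c) ≡ s * a + - c * s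
  distrib = solve-∀

∑-sgn-⊆ : ∀ {n} (F : Subset n) → ∑[ S ∈ allSubsets n ] [ S ⊆ᵇ F ]· sgn ∣ S ∣ ≡ [ ∅ =ᵇ F ]· 1ℤ
∑-sgn-⊆ {n} F = begin
  ∑[ S ∈ allSubsets n ] [ S ⊆ᵇ F ]· sgn ∣ S ∣
    ≡⟨ ∑-cong (allSubsets n) (λ {S} _ → trans (sym ([]·-absorb (∅ ⊆ᵇ S) (S ⊆ᵇ F) _ (λ _ → ⊆⇒⊆ᵇ ∅ S ⊥⊆)))
                                              ([]·-∧ (∅ ⊆ᵇ S) (S ⊆ᵇ F) _)) ⟩
  ∑[ S ∈ allSubsets n ] [ ∅ ⊆ᵇ S ∧ S ⊆ᵇ F ]· sgn ∣ S ∣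
    ≡⟨ ∑-sgn-interval ∅ F ⟩
  [ ∅ =ᵇ F ]· sgn ∣ F ∣
    ≡⟨ []·-cong (∅ =ᵇ F) (λ ∅=F → cong sgn (trans (cong ∣_∣ (sym (=ᵇ⇒≡ ∅ F ∅=F))) (∣⊥∣≡0 n))) ⟩
  [ ∅ =ᵇ F ]· 1ℤ ∎
  where open ≡-Reasoning

-- Closure operators and the flats of a matroid

module _ {n : ℕ} where

  ∪-least : ∀ {X Y Z : Subset n} → X ⊆ Z → Y ⊆ Z → X ∪ Y ⊆ Z
  ∪-least X⊆Z Y⊆Z x∈ = [ X⊆Z , Y⊆Z ]′ (x∈p∪q⁻ _ _ x∈)

  ∪-monoʳ : ∀ (X : Subset n) {Y Z} → Y ⊆ Z → X ∪ Y ⊆ X ∪ Z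
  ∪-monoʳ X Y⊆Z = ∪-least (p⊆p∪q _) (⊆-trans Y⊆Z (q⊆p∪q X _))

  ∪-monoˡ : ∀ (Z : Subset n) {X Y} → X ⊆ Y → X ∪ Z ⊆ Y ∪ Z
  ∪-monoˡ Z X⊆Y = ∪-least (⊆-trans X⊆Y (p⊆p∪q Z)) (q⊆p∪q _ Z)

  ⁅⁆⊆ : ∀ {e} {X : Subset n} → e ∈ₛ X → ⁅ e ⁆ ⊆ X
  ⁅⁆⊆ {e} {X} e∈X x∈ = subst (_∈ₛ X) (sym (x∈⁅y⁆⇒x≡y e x∈)) e∈X

module ClosureOperator {n : ℕ} (cl : Subset n → Subset n)
  (extensive : ∀ S → S ⊆ cl S)
  (monotone : ∀ {S X} → S ⊆ X → cl S ⊆ cl X)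
  (idempotent : ∀ S → cl (cl S) ≡ cl S) where

  closedSets : List (Subset n)
  closedSets = filter (λ F → T? (cl F =ᵇ F)) (allSubsets n)

  closedSets-unique : Unique closedSets
  closedSets-unique = Unique.filter⁺ _ (allSubsets-unique n)

  closure-closed : ∀ S → cl S ∈ closedSets
  closure-closed S = ∈-filter⁺ (λ F → T? (cl F =ᵇ F)) (allSubsets-complete (cl S)) (≡⇒=ᵇ _ _ (idempotent S))

  closure-⊆ᵇ : ∀ {F} → F ∈ closedSets → ∀ S → (cl S ⊆ᵇ F) ≡ (S ⊆ᵇ F)
  closure-⊆ᵇ {F} F∈ S =
    does-⇔ (mk⇔ (⊆-trans (extensive S)) (subst (cl S ⊆_) clF≡F ∘ monotone)) (cl S ⊆? F) (S ⊆? F)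
    where
    clF≡F : cl F ≡ F
    clF≡F = =ᵇ⇒≡ (cl F) F (proj₂ (∈-filter⁻ (λ F → T? (cl F =ᵇ F)) {xs = allSubsets n} F∈))

  ∑-fibres : ∀ (φ : Subset n → Subset n → ℤ) →
             ∑[ F ∈ closedSets ] ∑[ S ∈ allSubsets n ] [ cl S =ᵇ F ]· φ S F ≡ ∑[ S ∈ allSubsets n ] φ S (cl S)
  ∑-fibres φ = trans (∑-comm closedSets (allSubsets n) _)
    (∑-cong (allSubsets n) (λ {S} _ →
      ∑-pick (λ F → cl S =ᵇ F) (φ S) closedSets-unique (closure-closed S)
             (sym ∘ =ᵇ⇒≡ (cl S) _) (≡⇒=ᵇ (cl S) (cl S) refl)))

  mobius-closedSets : ∀ {F} → F ∈ closedSets →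
                      mobius closedSets _⊆ᵇ_ _=ᵇ_ ∅ F ≡ ∑[ S ∈ allSubsets n ] [ cl S =ᵇ F ]· sgn ∣ S ∣
  mobius-closedSets = Mobius.mobius-intervalSums ⊆ᵇ-isBoolPoset closedSets ∅
                        closedSets-unique (λ F → ⊆⇒⊆ᵇ ∅ F ⊥⊆) intervalSum
    where
    intervalSum : ∀ {F} → F ∈ closedSets →
                  ∑[ G ∈ closedSets ] [ G ⊆ᵇ F ]· (∑[ S ∈ allSubsets n ] [ cl S =ᵇ G ]· sgn ∣ S ∣) ≡ [ ∅ =ᵇ F ]· 1ℤ
    intervalSum {F} F∈ = begin
      ∑[ G ∈ closedSets ] [ G ⊆ᵇ F ]· (∑[ S ∈ allSubsets n ] [ cl S =ᵇ G ]· sgn ∣ S ∣)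
        ≡⟨ ∑-cong closedSets (λ {G} _ → trans ([]·-∑ (G ⊆ᵇ F) (allSubsets n) _)
                                              (∑-cong (allSubsets n) (λ {S} _ → []·-comm (G ⊆ᵇ F) (cl S =ᵇ G) _))) ⟩
      ∑[ G ∈ closedSets ] ∑[ S ∈ allSubsets n ] [ cl S =ᵇ G ]· [ G ⊆ᵇ F ]· sgn ∣ S ∣
        ≡⟨ ∑-fibres (λ S G → [ G ⊆ᵇ F ]· sgn ∣ S ∣) ⟩
      ∑[ S ∈ allSubsets n ] [ cl S ⊆ᵇ F ]· sgn ∣ S ∣
        ≡⟨ ∑-cong (allSubsets n) (λ {S} _ → cong ([_]· sgn ∣ S ∣) (closure-⊆ᵇ F∈ S)) ⟩
      ∑[ S ∈ allSubsets n ] [ S ⊆ᵇ F ]· sgn ∣ S ∣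
        ≡⟨ ∑-sgn-⊆ F ⟩
      [ ∅ =ᵇ F ]· 1ℤ ∎
      where open ≡-Reasoning

module MatroidClosure {m : ℕ} (M : Matroid m) where

  private
    r : Subset m → ℕ
    r = ρ M

    mono : ∀ {X Y} → X ⊆ Y → r X ≤ r Y
    mono = monotone M _ _

  ∈-closure⁻ : ∀ {S e} → e ∈ₛ closure M S → r (S ∪ ⁅ e ⁆) ≡ r S
  ∈-closure⁻ {S} {e} e∈ = ℕ.≡ᵇ⇒≡ _ _ (Equivalence.from Bool.T-≡
    (trans (sym (Vec.lookup∘tabulate (λ e → r (S ∪ ⁅ e ⁆) ≡ᵇ r S) e)) (Vec.[]=⇒lookup e∈)))

  ∈-closure⁺ : ∀ {S e} → r (S ∪ ⁅ e ⁆) ≡ r S → e ∈ₛ closure M S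
  ∈-closure⁺ {S} {e} eq = Vec.lookup⇒[]= e (closure M S)
    (trans (Vec.lookup∘tabulate (λ e → r (S ∪ ⁅ e ⁆) ≡ᵇ r S) e) (Equivalence.to Bool.T-≡ (ℕ.≡⇒≡ᵇ _ _ eq)))

  closure-extensive : ∀ S → S ⊆ closure M S
  closure-extensive S e∈S = ∈-closure⁺ (ℕ.≤-antisym (mono (∪-least ⊆-refl (⁅⁆⊆ e∈S))) (mono (p⊆p∪q _)))

  -- submodularity applied to X and S ∪ {e}
  closure-monotone : ∀ {S X} → S ⊆ X → closure M S ⊆ closure M X
  closure-monotone {S} {X} S⊆X {e} e∈ = ∈-closure⁺ (ℕ.≤-antisym (ℕ.+-cancelʳ-≤ (r S) _ _ bound) (mono (p⊆p∪q _)))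
    where
    open ℕ.≤-Reasoning
    bound : r (X ∪ ⁅ e ⁆) +ℕ r S ≤ r X +ℕ r S
    bound = begin
      r (X ∪ ⁅ e ⁆) +ℕ r S
        ≤⟨ ℕ.+-mono-≤ (mono (∪-monoʳ X (q⊆p∪q S ⁅ e ⁆))) (mono (λ x∈ → x∈p∩q⁺ (S⊆X x∈ , p⊆p∪q _ x∈))) ⟩
      r (X ∪ (S ∪ ⁅ e ⁆)) +ℕ r (X ∩ (S ∪ ⁅ e ⁆))
        ≤⟨ submod M X (S ∪ ⁅ e ⁆) ⟩
      r X +ℕ r (S ∪ ⁅ e ⁆)
        ≡⟨ cong (r X +ℕ_) (∈-closure⁻ e∈) ⟩
      r X +ℕ r S ∎

  private
    adjoin : Subset m → List (Fin m) → Subset m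
    adjoin S = foldr (λ e X → X ∪ ⁅ e ⁆) S

    ⊆-adjoin : ∀ S es → S ⊆ adjoin S es
    ⊆-adjoin S []       = ⊆-refl
    ⊆-adjoin S (e ∷ es) = ⊆-trans (⊆-adjoin S es) (p⊆p∪q _)

    ∈-adjoin : ∀ S {e es} → e ∈ es → e ∈ₛ adjoin S es
    ∈-adjoin S {es = e ∷ es} (here refl) = q⊆p∪q (adjoin S es) ⁅ e ⁆ (x∈⁅x⁆ e)
    ∈-adjoin S {es = _ ∷ es} (there e∈) = p⊆p∪q _ (∈-adjoin S e∈)

    rank-adjoin : ∀ S es → (∀ {e} → e ∈ es → e ∈ₛ closure M S) → r (adjoin S es) ≡ r S
    rank-adjoin S []       _  = refl
    rank-adjoin S (e ∷ es) es⊆cl =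
      trans (∈-closure⁻ (closure-monotone (⊆-adjoin S es) (es⊆cl (here refl)))) (rank-adjoin S es (es⊆cl ∘ there))

  rank-closure : ∀ S → r (closure M S) ≡ r S
  rank-closure S = ℕ.≤-antisym (ℕ.≤-trans (mono cl⊆) (ℕ.≤-reflexive (rank-adjoin S elems elems⊆cl)))
                               (mono (closure-extensive S))
    where
    elems : List (Fin m)
    elems = filter (_∈? closure M S) (allFin m)
    elems⊆cl : ∀ {e} → e ∈ elems → e ∈ₛ closure M S
    elems⊆cl = proj₂ ∘ ∈-filter⁻ (_∈? closure M S) {xs = allFin m}
    cl⊆ : closure M S ⊆ adjoin S elems
    cl⊆ {e} e∈ = ∈-adjoin S (∈-filter⁺ (_∈? closure M S) (∈-allFin e) e∈)

  closure-idempotent : ∀ S → closure M (closure M S) ≡ closure M S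
  closure-idempotent S = ⊆-antisym cl²⊆cl (closure-extensive (closure M S))
    where
    cl²⊆cl : closure M (closure M S) ⊆ closure M S
    cl²⊆cl {e} e∈ = ∈-closure⁺ (ℕ.≤-antisym
      (ℕ.≤-trans (mono (∪-monoˡ ⁅ e ⁆ (closure-extensive S))) (ℕ.≤-reflexive (trans (∈-closure⁻ e∈) (rank-closure S))))
      (mono (p⊆p∪q _)))

  closure-∅ : Loopless M → closure M ∅ ≡ ∅
  closure-∅ loopless = ⊆-antisym (⊥-elim ∘ loop) ⊥⊆
    where
    loop : ∀ {e} → ¬ e ∈ₛ closure M ∅
    loop {e} e∈ = ℕ.1+n≰n (ℕ.≤-trans (ℕ.≤-reflexive 1≡r∅) (ℕ.≤-trans (bounded M ∅) (ℕ.≤-reflexive (∣⊥∣≡0 m))))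
      where
      1≡r∅ : 1 ≡ r ∅
      1≡r∅ = trans (sym (loopless e)) (trans (cong r (sym (∪-identityˡ ⁅ e ⁆))) (∈-closure⁻ e∈))

charPoly-subsetExpansion : ∀ {m} (M : Matroid m) → Loopless M → ∀ t →
  charPoly M t ≡ ∑[ S ∈ allSubsets m ] sgn ∣ S ∣ * t ^ℤ (rank M ∸ ρ M S)
charPoly-subsetExpansion {m} M loopless t = begin
  charPoly M t
    ≡⟨ ∑-cong (flats M) (λ {F} F∈ → cong (_* t ^ℤ (d ∸ ρ M F)) (μ-flats F∈)) ⟩
  ∑[ F ∈ flats M ] (∑[ S ∈ allSubsets m ] [ closure M S =ᵇ F ]· sgn ∣ S ∣) * t ^ℤ (d ∸ ρ M F)
    ≡⟨ ∑-cong (flats M) (λ {F} _ → trans (∑-*ʳ _ (allSubsets m) _)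
                                         (∑-cong (allSubsets m) (λ {S} _ → []·-*ʳ (closure M S =ᵇ F) _ _))) ⟩
  ∑[ F ∈ flats M ] ∑[ S ∈ allSubsets m ] [ closure M S =ᵇ F ]· (sgn ∣ S ∣ * t ^ℤ (d ∸ ρ M F))
    ≡⟨ ∑-fibres (λ S F → sgn ∣ S ∣ * t ^ℤ (d ∸ ρ M F)) ⟩
  ∑[ S ∈ allSubsets m ] sgn ∣ S ∣ * t ^ℤ (d ∸ ρ M (closure M S))
    ≡⟨ ∑-cong (allSubsets m) (λ {S} _ → cong (λ k → sgn ∣ S ∣ * t ^ℤ (d ∸ k)) (rank-closure S)) ⟩
  ∑[ S ∈ allSubsets m ] sgn ∣ S ∣ * t ^ℤ (d ∸ ρ M S) ∎
  where
  open ≡-Reasoning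
  open MatroidClosure M
  open ClosureOperator (closure M) closure-extensive closure-monotone closure-idempotent
  d = rank M
  μ-flats : ∀ {F} → F ∈ flats M →
            mobius (flats M) _⊆ᵇ_ _=ᵇ_ (minFlat M) F ≡ ∑[ S ∈ allSubsets m ] [ closure M S =ᵇ F ]· sgn ∣ S ∣
  μ-flats {F} F∈ = trans (cong (λ x → mobius (flats M) _⊆ᵇ_ _=ᵇ_ x F) (closure-∅ loopless)) (mobius-closedSets F∈)

-- The posets L_i

module UpClosedFamily {n : ℕ} {P : Pred (Subset n) 0ℓ} (P? : Decidable P)
                      (up-closed : ∀ {R S} → P R → R ⊆ S → P S) where

  family : List (Subset n)
  family = filter P? (allSubsets n)

  family-unique : Unique family
  family-unique = Unique.filter⁺ P? (allSubsets-unique n)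

  mobiusBelow : Subset n → ℤ
  mobiusBelow S = - (∑[ R ∈ family ] [ R ⊆ᵇ S ]· (sgn ∣ R ∣ * sgn ∣ S ∣))

  ∑-mobiusBelow : ∀ {S} → S ∈ family → ∑[ T ∈ family ] [ T ⊆ᵇ S ]· mobiusBelow T ≡ - 1ℤ
  ∑-mobiusBelow {S} S∈ = begin
    ∑[ T ∈ family ] [ T ⊆ᵇ S ]· mobiusBelow T
      ≡⟨ ∑-cong family (λ {T} _ → expand T) ⟩
    ∑[ T ∈ family ] - (∑[ R ∈ family ] [ R ⊆ᵇ T ∧ T ⊆ᵇ S ]· (sgn ∣ R ∣ * sgn ∣ T ∣))
      ≡⟨ sym (∑-neg family _) ⟩
    - (∑[ T ∈ family ] ∑[ R ∈ family ] [ R ⊆ᵇ T ∧ T ⊆ᵇ S ]· (sgn ∣ R ∣ * sgn ∣ T ∣))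
      ≡⟨ cong -_ (∑-comm family family _) ⟩
    - (∑[ R ∈ family ] ∑[ T ∈ family ] [ R ⊆ᵇ T ∧ T ⊆ᵇ S ]· (sgn ∣ R ∣ * sgn ∣ T ∣))
      ≡⟨ cong -_ (∑-cong family (λ {R} R∈ → interval R R∈)) ⟩
    - (∑[ R ∈ family ] [ R =ᵇ S ]· (sgn ∣ R ∣ * sgn ∣ S ∣))
      ≡⟨ cong -_ (∑-pick (_=ᵇ S) (λ R → sgn ∣ R ∣ * sgn ∣ S ∣) family-unique S∈ (=ᵇ⇒≡ _ S) (≡⇒=ᵇ S S refl)) ⟩
    - (sgn ∣ S ∣ * sgn ∣ S ∣)
      ≡⟨ cong -_ (sgn-square ∣ S ∣) ⟩
    - 1ℤ ∎
    where
    open ≡-Reasoning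
    expand : ∀ T → [ T ⊆ᵇ S ]· mobiusBelow T ≡ - (∑[ R ∈ family ] [ R ⊆ᵇ T ∧ T ⊆ᵇ S ]· (sgn ∣ R ∣ * sgn ∣ T ∣))
    expand T = trans ([]·-neg (T ⊆ᵇ S) _) (cong -_ (trans ([]·-∑ (T ⊆ᵇ S) family _)
      (∑-cong family (λ {R} _ → trans ([]·-comm (T ⊆ᵇ S) (R ⊆ᵇ T) _) ([]·-∧ (R ⊆ᵇ T) (T ⊆ᵇ S) _)))))
    -- every T above some R ∈ family lies in the family
    interval : ∀ R → R ∈ family →
               ∑[ T ∈ family ] [ R ⊆ᵇ T ∧ T ⊆ᵇ S ]· (sgn ∣ R ∣ * sgn ∣ T ∣) ≡ [ R =ᵇ S ]· (sgn ∣ R ∣ * sgn ∣ S ∣)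
    interval R R∈ = begin
      ∑[ T ∈ family ] [ R ⊆ᵇ T ∧ T ⊆ᵇ S ]· (sgn ∣ R ∣ * sgn ∣ T ∣)
        ≡⟨ ∑-filter-redundant P? (allSubsets n) (λ T → R ⊆ᵇ T ∧ T ⊆ᵇ S) _
             (λ {T} R⊆T∧T⊆S → up-closed PR (⊆ᵇ⇒⊆ R T (proj₁ (T-∧⁻ R⊆T∧T⊆S)))) ⟩
      ∑[ T ∈ allSubsets n ] [ R ⊆ᵇ T ∧ T ⊆ᵇ S ]· (sgn ∣ R ∣ * sgn ∣ T ∣)
        ≡⟨ ∑-cong (allSubsets n) (λ {T} _ → sym ([]·-*ˡ (R ⊆ᵇ T ∧ T ⊆ᵇ S) (sgn ∣ R ∣) (sgn ∣ T ∣))) ⟩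
      ∑[ T ∈ allSubsets n ] sgn ∣ R ∣ * [ R ⊆ᵇ T ∧ T ⊆ᵇ S ]· sgn ∣ T ∣
        ≡⟨ sym (∑-*ˡ (sgn ∣ R ∣) (allSubsets n) _) ⟩
      sgn ∣ R ∣ * (∑[ T ∈ allSubsets n ] [ R ⊆ᵇ T ∧ T ⊆ᵇ S ]· sgn ∣ T ∣)
        ≡⟨ cong (sgn ∣ R ∣ *_) (∑-sgn-interval R S) ⟩
      sgn ∣ R ∣ * [ R =ᵇ S ]· sgn ∣ S ∣
        ≡⟨ []·-*ˡ (R =ᵇ S) (sgn ∣ R ∣) (sgn ∣ S ∣) ⟩
      [ R =ᵇ S ]· (sgn ∣ R ∣ * sgn ∣ S ∣) ∎
      where
      PR : P R
      PR = proj₂ (∈-filter⁻ P? {xs = allSubsets n} R∈)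

  mobius-adjoinedBottom : ∀ {S} → S ∈ family →
                          mobius (nothing ∷ map just family) leL eqL nothing (just S) ≡ mobiusBelow S
  mobius-adjoinedBottom S∈ =
    Mobius.mobius-intervalSums leL-isBoolPoset (nothing ∷ map just family) nothing
      unique (λ _ → _) {maybe mobiusBelow 1ℤ} intervalSum (there (∈-map⁺ just S∈))
    where
    unique : Unique (nothing ∷ map just family)
    unique = All.map⁺ (All.universal (λ _ ()) family) ∷ Unique.map⁺ Maybe.just-injective family-unique
    intervalSum : ∀ {y} → y ∈ nothing ∷ map just family →
                  ∑[ z ∈ nothing ∷ map just family ] [ leL z y ]· maybe mobiusBelow 1ℤ z ≡ [ eqL nothing y ]· 1ℤ
    intervalSum (here refl) = cong (1ℤ +_) (trans (∑-map just family _) (∑-zero family (λ _ → refl)))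
    intervalSum (there y∈) with ∈-map⁻ just y∈
    ... | S , S∈ , refl = trans (cong (1ℤ +_) (trans (∑-map just family _) (∑-mobiusBelow S∈))) (ℤ.+-inverseʳ 1ℤ)

module Coefficients {m : ℕ} (M : Matroid m) (d≤m : rank M ≤ m) where

  E : Subset m
  E = ⊤

  private
    d : ℕ
    d = rank M

    j : ℕ → ℕ
    j i = m ∸ d +ℕ 1 +ℕ i

    j+d : ∀ i → j i +ℕ d ≡ m +ℕ 1 +ℕ i
    j+d i = trans (rearrange (m ∸ d) i d) (cong (λ k → k +ℕ 1 +ℕ i) (ℕ.m∸n+n≡m d≤m))
      where
      rearrange : ∀ a i d → a +ℕ 1 +ℕ i +ℕ d ≡ a +ℕ d +ℕ 1 +ℕ i
      rearrange = ℕ-solve-∀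

  E∈Sᵢ : ∀ i → E ∈ Sᵢ M i
  E∈Sᵢ i = ∈-filter⁺ (λ S → d ∸ i ≤? ρ M S) (allSubsets-complete E) (ℕ.m∸n≤m d i)

  μᵢ-E : ∀ i → μᵢ M i E ≡ - ((∑[ R ∈ Sᵢ M i ] sgn ∣ R ∣) * sgn m)
  μᵢ-E i = begin
    μᵢ M i E                                         ≡⟨ mobius-adjoinedBottom (E∈Sᵢ i) ⟩
    - (∑[ R ∈ Sᵢ M i ] [ R ⊆ᵇ E ]· (sgn ∣ R ∣ * sgn ∣ E ∣))
                                                     ≡⟨ cong -_ (∑-cong (Sᵢ M i) (λ {R} _ → []·-true _ (⊆⇒⊆ᵇ R E ⊆⊤))) ⟩
    - (∑[ R ∈ Sᵢ M i ] sgn ∣ R ∣ * sgn ∣ E ∣)          ≡⟨ cong -_ (sym (∑-*ʳ (sgn ∣ E ∣) (Sᵢ M i) _)) ⟩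
    - (Aᵢ * sgn ∣ E ∣)                                ≡⟨ cong (λ k → - (Aᵢ * sgn k)) (∣⊤∣≡n m) ⟩
    - (Aᵢ * sgn m)                                   ∎
    where
    open ≡-Reasoning
    open UpClosedFamily (λ S → d ∸ i ≤? ρ M S) (λ d∸i≤ρR R⊆S → ℕ.≤-trans d∸i≤ρR (monotone M _ _ R⊆S))
    Aᵢ = ∑[ R ∈ Sᵢ M i ] sgn ∣ R ∣

  -- only S = E has #S - d + 1 + i = m - d + 1 + i
  ω-top : ∀ i → ω M (j i) i ≡ sgn (j i) * μᵢ M i E
  ω-top i = cong (sgn (j i) *_)
    (∑-pick (λ S → (∣ S ∣ +ℕ 1 +ℕ i) ≡ᵇ (j i +ℕ d)) (μᵢ M i) (Unique.filter⁺ _ (allSubsets-unique m)) (E∈Sᵢ i)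
            (λ {S} hit → ∣p∣≡n⇒p≡⊤ (cancel (trans (ℕ.≡ᵇ⇒≡ _ _ hit) (j+d i))))
            (ℕ.≡⇒≡ᵇ _ _ (trans (cong (λ k → k +ℕ 1 +ℕ i) (∣⊤∣≡n m)) (sym (j+d i)))))
    where
    cancel : ∀ {k} → k +ℕ 1 +ℕ i ≡ m +ℕ 1 +ℕ i → k ≡ m
    cancel = ℕ.+-cancelʳ-≡ 1 _ _ ∘ ℕ.+-cancelʳ-≡ i _ _

  ω-term : ∀ t i → sgn d * (ω M (j i) i * (- t) ^ℤ i) ≡ (∑[ R ∈ Sᵢ M i ] sgn ∣ R ∣) * t ^ℤ i
  ω-term t i rewrite ω-top i | μᵢ-E i | neg-^ t i =
    cancel-signs (sgn d) (sgn (j i)) (sgn m) (sgn i) (∑[ R ∈ Sᵢ M i ] sgn ∣ R ∣) (t ^ℤ i)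
                 signs (sgn-square m) (sgn-square i)
    where
    signs : sgn d * sgn (j i) ≡ - (sgn m * sgn i)
    signs = begin
      sgn d * sgn (j i)      ≡⟨ sym (sgn-+ d (j i)) ⟩
      sgn (d +ℕ j i)         ≡⟨ cong sgn (trans (ℕ.+-comm d (j i)) (trans (j+d i) (ℕ.+-assoc m 1 i))) ⟩
      sgn (m +ℕ suc i)       ≡⟨ sgn-+ m (suc i) ⟩
      sgn m * - sgn i        ≡⟨ sym (ℤ.neg-distribʳ-* (sgn m) (sgn i)) ⟩
      - (sgn m * sgn i)      ∎
      where open ≡-Reasoning
    cancel-signs : ∀ a b s u A p → a * b ≡ - (s * u) → s * s ≡ 1ℤ → u * u ≡ 1ℤ →
                   a * (b * - (A * s) * (u * p)) ≡ A * p
    cancel-signs a b s u A p ab s² u² = begin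
      a * (b * - (A * s) * (u * p))        ≡⟨ regroup a b s u A p ⟩
      (a * b) * - (s * u) * (A * p)        ≡⟨ cong (λ z → z * - (s * u) * (A * p)) ab ⟩
      - (s * u) * - (s * u) * (A * p)      ≡⟨ square s u A p ⟩
      (s * s) * (u * u) * (A * p)          ≡⟨ cong₂ (λ x y → x * y * (A * p)) s² u² ⟩
      1ℤ * 1ℤ * (A * p)                    ≡⟨ ℤ.*-identityˡ (A * p) ⟩
      A * p                                ∎
      where
      open ≡-Reasoning
      regroup : ∀ a b s u A p → a * (b * - (A * s) * (u * p)) ≡ (a * b) * - (s * u) * (A * p)
      regroup = solve-∀
      square : ∀ s u A p → - (s * u) * - (s * u) * (A * p) ≡ (s * s) * (u * u) * (A * p)
      square = solve-∀

ωSum-subsetExpansion : ∀ {m} (M : Matroid m) → 1 ≤ m → rank M ≤ m → ∀ t →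
  sgn (rank M) * ((1ℤ - t) * Σ< (rank M) (λ i → ω M (m ∸ rank M +ℕ 1 +ℕ i) i * ((- t) ^ℤ i)))
    ≡ ∑[ S ∈ allSubsets m ] sgn ∣ S ∣ * t ^ℤ (rank M ∸ ρ M S)
ωSum-subsetExpansion {m} M 1≤m d≤m t = begin
  sgn d * ((1ℤ - t) * Σ< d (λ i → ω M (m ∸ d +ℕ 1 +ℕ i) i * ((- t) ^ℤ i)))
    ≡⟨ x∙yz≈y∙xz (sgn d) (1ℤ - t) _ ⟩
  (1ℤ - t) * (sgn d * Σ< d (λ i → ω M (m ∸ d +ℕ 1 +ℕ i) i * ((- t) ^ℤ i)))
    ≡⟨ cong ((1ℤ - t) *_) (trans (Σ<-*ˡ (sgn d) d _) (Σ<-cong d (ω-term t))) ⟩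
  (1ℤ - t) * Σ< d (λ i → (∑[ R ∈ Sᵢ M i ] sgn ∣ R ∣) * t ^ℤ i)
    ≡⟨ cong ((1ℤ - t) *_) (Σ<-cong d (λ i → cong (_* t ^ℤ i) (∑-filter (λ S → d ∸ i ≤? ρ M S) (allSubsets m) _))) ⟩
  (1ℤ - t) * Σ< d (λ i → (∑[ R ∈ allSubsets m ] [ does (d ∸ i ≤? ρ M R) ]· sgn ∣ R ∣) * t ^ℤ i)
    ≡⟨ ∑-geometric (allSubsets m) (λ R → sgn ∣ R ∣) (ρ M) d t ⟩
  ∑[ S ∈ allSubsets m ] sgn ∣ S ∣ * (t ^ℤ (d ∸ ρ M S) - t ^ℤ d)
    ≡⟨ ∑-sgn-shift 1≤m (λ S → t ^ℤ (d ∸ ρ M S)) (t ^ℤ d) ⟩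
  ∑[ S ∈ allSubsets m ] sgn ∣ S ∣ * t ^ℤ (d ∸ ρ M S) ∎
  where
  open ≡-Reasoning
  open Coefficients M d≤m
  d = rank M

corollary2p9 : ∀ {m : ℕ} (M : Matroid m) → 1 ≤ rank M → Loopless M →
    ∀ (t : ℤ) →
      charPoly M t
        ≡ sgn (rank M) * ((1ℤ - t)
            * Σ< (rank M) (λ i → ω M (m ∸ rank M +ℕ 1 +ℕ i) i * ((- t) ^ℤ i)))
corollary2p9 {m} M 1≤d loopless t = begin
  charPoly M t
    ≡⟨ charPoly-subsetExpansion M loopless t ⟩
  ∑[ S ∈ allSubsets m ] sgn ∣ S ∣ * t ^ℤ (rank M ∸ ρ M S)
    ≡⟨ sym (ωSum-subsetExpansion M (ℕ.≤-trans 1≤d d≤m) d≤m t) ⟩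
  sgn (rank M) * ((1ℤ - t) * Σ< (rank M) (λ i → ω M (m ∸ rank M +ℕ 1 +ℕ i) i * ((- t) ^ℤ i))) ∎
  where
  open ≡-Reasoning
  d≤m : rank M ≤ m
  d≤m = ℕ.≤-trans (bounded M ⊤) (ℕ.≤-reflexive (∣⊤∣≡n m))
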